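{- Let $G\in\mathbb{Im}^\infty$ and $n\ge 0$. Then $G=_{\mathbb{Im}^\infty}*n$ if and only if $o(G+*n)=\mathscr P$.
   Context: Affine normal play forms $\mathbb{Np}^\infty$ are defined recursively: two atomic forms $\infty$ and $\overline{\infty}$ with no options; every other form is $G=\{G^{\mathcal L}\mid G^{\mathcal R}\}$ with finite nonempty sets of previously constructed forms as Left and Right options. Followers of $G$: $G$ and followers of its options. Disjunctive sum: $\infty+X=X+\infty=\infty$ for $X\neq\overline{\infty}$; $\overline{\infty}+X=X+\overline{\infty}=\overline{\infty}$ for $X\ne\infty$; $\infty+\overline{\infty}$ undefined; otherwise $G+H=\{G^L+H,G+H^L\mid G^R+H,G+H^R\}$. Outcomes: Left wins $\infty$ and Right wins $\overline{\infty}$ whoever moves; otherwise play alternates, Left moving first wins iff some Left option is won by Left moving second, Left moving second wins iff every Right option is won by Left moving first, symmetrically for Right. $o(G)\in\{\mathscr L,\mathscr N,\mathscr P,\mathscr R\}$: Left wins either way, first player wins, second player wins, Right wins either way. Nimbers: $*0=\{\overline\infty\mid\infty\}$, $*n=\{*0,\dots,*(n-1)\mid *0,\dots,*(n-1)\}$. Conjugate $\overline G$: swaps $\infty,\overline\infty$, otherwise $\{\overline{G^R}\mid\overline{G^L}\}$. $G\notin\{\infty,\overline\infty\}$ is a check if $\infty\in G^{\mathcal L}$ or $\overline\infty\in G^{\mathcal R}$, and quiet if it is not a check. Symmetric: $G\notin\{\infty,\overline\infty\}$ and $G^{\mathcal R}=\{\overline{G^L}:G^L\in G^{\mathcal L}\}$.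 Affine impartial: symmetric and all quiet followers symmetric; the set of these is $\mathbb{Im}^\infty$. For $G,H\in\mathbb{Im}^\infty$, $G=_{\mathbb{Im}^\infty}H$ iff $o(G+X)=o(H+X)$ for all $X\in\mathbb{Im}^\infty$. -}

module Defs where

open import Data.Nat using (ℕ; zero; suc; _+_)
open import Data.Fin using (Fin; zero; suc; splitAt)
open import Data.Sum using (_⊎_; inj₁; inj₂; [_,_])
open import Data.Product using (Σ; ∃; _×_; _,_)
open import Data.Bool using (Bool; true; false; _∧_; _∨_; not)
open import Data.Unit using (⊤)
open import Data.Empty using (⊥)
open import Relation.Nullary using (¬_)
open import Relation.Binary.PropositionalEquality using (_≡_)

-- Affine normal play forms.  Forms are identified up to the set of options
-- via the relation _≅_ below (hereditary set identity).
data Form : Set where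
  ∞    : Form
  ∞bar : Form
  node : (m : ℕ) → (Fin (suc m) → Form) → (n : ℕ) → (Fin (suc n) → Form) → Form

_≅_ : Form → Form → Set
∞ ≅ ∞ = ⊤
∞ ≅ ∞bar = ⊥
∞ ≅ node _ _ _ _ = ⊥
∞bar ≅ ∞ = ⊥
∞bar ≅ ∞bar = ⊤
∞bar ≅ node _ _ _ _ = ⊥
node _ _ _ _ ≅ ∞ = ⊥
node _ _ _ _ ≅ ∞bar = ⊥
node m gL n gR ≅ node m' hL n' hR =
  ((∀ i → ∃ λ j → gL i ≅ hL j) × (∀ j → ∃ λ i → gL i ≅ hL j)) ×
  ((∀ i → ∃ λ j → gR i ≅ hR j) × (∀ j → ∃ λ i → gR i ≅ hR j))

-- disjunctive sum.  The undefined case ∞ + ∞bar is (arbitrarily) sent to ∞;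
-- it never arises when summing two non-atomic forms.
_⊕_ : Form → Form → Form
∞ ⊕ _ = ∞
∞bar ⊕ ∞ = ∞
∞bar ⊕ _ = ∞bar
node _ _ _ _ ⊕ ∞ = ∞
node _ _ _ _ ⊕ ∞bar = ∞bar
G@(node m gL n gR) ⊕ H@(node m' hL n' hR) =
  node (m + suc m') (λ i → [ (λ j → gL j ⊕ H) , (λ j → G ⊕ hL j) ] (splitAt (suc m) i))
       (n + suc n') (λ i → [ (λ j → gR j ⊕ H) , (λ j → G ⊕ hR j) ] (splitAt (suc n) i))

anyF : (m : ℕ) → (Fin (suc m) → Bool) → Bool
anyF zero f = f zero
anyF (suc m) f = f zero ∨ anyF m (λ i → f (suc i))

allF : (m : ℕ) → (Fin (suc m) → Bool) → Bool
allF zero f = f zero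
allF (suc m) f = f zero ∧ allF m (λ i → f (suc i))

-- winning: lf = Left wins moving first, ls = Left wins moving second,
-- rf / rs likewise for Right.
lf ls rf rs : Form → Bool
lf ∞ = true
lf ∞bar = false
lf (node m gL n gR) = anyF m (λ i → ls (gL i))
ls ∞ = true
ls ∞bar = false
ls (node m gL n gR) = allF n (λ j → lf (gR j))
rf ∞ = false
rf ∞bar = true
rf (node m gL n gR) = anyF n (λ j → rs (gR j))
rs ∞ = false
rs ∞bar = true
rs (node m gL n gR) = allF m (λ i → rf (gL i))

data Outcome : Set where
  𝓛 𝓝 𝓟 𝓡 : Outcome

outcome : Form → Outcome
outcome G with lf G | rf G
... | true  | false = 𝓛
... | true  | true  = 𝓝
... | false | false = 𝓟
... | false | true  = 𝓡

-- nimbers; below k lists *(k-1), ..., *0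
nim : ℕ → Form
below : (k : ℕ) → Fin k → Form
nim zero = node 0 (λ _ → ∞bar) 0 (λ _ → ∞)
nim (suc k) = node k (below (suc k)) k (below (suc k))
below (suc k) zero = nim k
below (suc k) (suc i) = below k i

conj : Form → Form
conj ∞ = ∞bar
conj ∞bar = ∞
conj (node m gL n gR) = node n (λ j → conj (gR j)) m (λ i → conj (gL i))

NonAtomic : Form → Set
NonAtomic (node _ _ _ _) = ⊤
NonAtomic ∞ = ⊥
NonAtomic ∞bar = ⊥

Check : Form → Set
Check ∞ = ⊥
Check ∞bar = ⊥
Check (node m gL n gR) = (∃ λ i → gL i ≡ ∞) ⊎ (∃ λ j → gR j ≡ ∞bar)

Quiet : Form → Set
Quiet G = NonAtomic G × ¬ Check G

Symmetric : Form → Set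
Symmetric ∞ = ⊥
Symmetric ∞bar = ⊥
Symmetric (node m gL n gR) =
  (∀ j → ∃ λ i → gR j ≅ conj (gL i)) × (∀ i → ∃ λ j → gR j ≅ conj (gL i))

data Follower : Form → Form → Set where
  self : ∀ {G} → Follower G G
  viaL : ∀ {F m gL n gR} (i : Fin (suc m)) → Follower F (gL i) → Follower F (node m gL n gR)
  viaR : ∀ {F m gL n gR} (j : Fin (suc n)) → Follower F (gR j) → Follower F (node m gL n gR)

Impartial : Form → Set
Impartial G = Symmetric G × (∀ F → Follower F G → Quiet F → Symmetric F)

_=Im_ : Form → Form → Set
G =Im H = ∀ X → Impartial X → outcome (G ⊕ X) ≡ outcome (H ⊕ X)

module Submission where

-- Call a form N a mirror form if every option of N, except a suicidal move to the
-- opponent's winning atom, is available to both players and is again a mirror form;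
-- every nimber is one.  If A ⊕ N is a P-position, a player who wins N ⊕ X can win
-- A ⊕ X by playing A ⊕ N and N ⊕ X side by side and copying each move in one copy of
-- N into the other.  With determinacy this gives o(A ⊕ X) = o(N ⊕ X) for every X,
-- and N ⊕ N is a P-position by the plain copycat strategy.

open import Defs
open import Data.Nat using (ℕ; zero; suc)
open import Data.Fin using (Fin; zero; suc; splitAt; _↑ˡ_; _↑ʳ_)
open import Data.Fin.Properties using (splitAt-↑ˡ; splitAt-↑ʳ)
open import Data.Sum using (_⊎_; inj₁; inj₂; [_,_])
open import Data.Product using (∃; _×_; _,_; proj₁; proj₂)
open import Data.Bool using (Bool; true; false; _∧_; not)
open import Data.Bool.Properties using (not-injective; ⇔→≡)
open import Data.Unit using (tt)
open import Data.Empty using (⊥-elim)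
open import Function using (_∘_)
open import Function.Bundles using (_⇔_; mk⇔; Equivalence)
open import Induction.WellFounded using (Acc; acc; WellFounded)
open import Relation.Nullary using (¬_)
open import Relation.Binary.PropositionalEquality
  using (_≡_; _≢_; refl; sym; trans; cong; cong₂; subst; module ≡-Reasoning)

anyF-true⇒ : ∀ m {f : Fin (suc m) → Bool} → anyF m f ≡ true → ∃ λ i → f i ≡ true
anyF-true⇒ zero    e = zero , e
anyF-true⇒ (suc m) {f} e with f zero in f0
... | true  = zero , f0
... | false with anyF-true⇒ m e
...   | i , fi = suc i , fi

anyF-true⇐ : ∀ m {f : Fin (suc m) → Bool} i → f i ≡ true → anyF m f ≡ true
anyF-true⇐ zero    zero    fi = fi
anyF-true⇐ (suc m) zero    fi rewrite fi = refl
anyF-true⇐ (suc m) {f} (suc i) fi with f zero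
... | true  = refl
... | false = anyF-true⇐ m i fi

allF-true⇒ : ∀ m {f : Fin (suc m) → Bool} → allF m f ≡ true → ∀ i → f i ≡ true
allF-true⇒ zero    e zero = e
allF-true⇒ (suc m) {f} e i with f zero in f0
allF-true⇒ (suc m) e zero    | true = f0
allF-true⇒ (suc m) e (suc i) | true = allF-true⇒ m e i

allF-true⇐ : ∀ m {f : Fin (suc m) → Bool} → (∀ i → f i ≡ true) → allF m f ≡ true
allF-true⇐ zero    all = all zero
allF-true⇐ (suc m) all rewrite all zero = allF-true⇐ m (all ∘ suc)

allF-cong : ∀ m {f g : Fin (suc m) → Bool} → (∀ i → f i ≡ g i) → allF m f ≡ allF m g
allF-cong zero    f≡g = f≡g zero
allF-cong (suc m) f≡g = cong₂ _∧_ (f≡g zero) (allF-cong m (f≡g ∘ suc))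

anyF≡not-allF-not : ∀ m (f : Fin (suc m) → Bool) → anyF m f ≡ not (allF m (not ∘ f))
anyF≡not-allF-not zero    f with f zero
... | true  = refl
... | false = refl
anyF≡not-allF-not (suc m) f with f zero
... | true  = refl
... | false = anyF≡not-allF-not m (f ∘ suc)

data Player : Set where
  left right : Player

opponent : Player → Player
opponent left  = right
opponent right = left

opponent≢ : ∀ p → opponent p ≢ p
opponent≢ left  ()
opponent≢ right ()

opponent-involutive : ∀ p → opponent (opponent p) ≡ p
opponent-involutive left  = refl
opponent-involutive right = refl

winner : Player → Form
winner left  = ∞
winner right = ∞bar

data Turn : Set where
  first second : Turn

wins : Player → Turn → Form → Bool
wins left  first  = lf
wins left  second = ls
wins right first  = rf
wins right second = rs

Wins : Player → Turn → Form → Set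
Wins p t S = wins p t S ≡ true

data _⟶[_]_ : Form → Player → Form → Set where
  left-move  : ∀ {m gL n gR} i → node m gL n gR ⟶[ left ] gL i
  right-move : ∀ {m gL n gR} j → node m gL n gR ⟶[ right ] gR j

determinacy : ∀ p S → wins (opponent p) first S ≡ not (wins p second S)
determinacy left  ∞    = refl
determinacy left  ∞bar = refl
determinacy right ∞    = refl
determinacy right ∞bar = refl
determinacy left (node m gL n gR) = begin
  anyF n (rs ∘ gR)               ≡⟨ anyF≡not-allF-not n (rs ∘ gR) ⟩
  not (allF n (not ∘ rs ∘ gR))   ≡⟨ cong not (allF-cong n (sym ∘ determinacy right ∘ gR)) ⟩
  not (allF n (lf ∘ gR))         ∎
  where open ≡-Reasoning
determinacy right (node m gL n gR) = begin
  anyF m (ls ∘ gL)               ≡⟨ anyF≡not-allF-not m (ls ∘ gL) ⟩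
  not (allF m (not ∘ ls ∘ gL))   ≡⟨ cong not (allF-cong m (sym ∘ determinacy left ∘ gL)) ⟩
  not (allF m (rf ∘ gL))         ∎
  where open ≡-Reasoning

wins-first⇒move : ∀ p {G} → NonAtomic G → Wins p first G → ∃ λ H → G ⟶[ p ] H × Wins p second H
wins-first⇒move left  {node m _ _ _} _ w with anyF-true⇒ m w
... | i , wᵢ = _ , left-move i , wᵢ
wins-first⇒move right {node _ _ n _} _ w with anyF-true⇒ n w
... | j , wⱼ = _ , right-move j , wⱼ

move⇒wins-first : ∀ {p G H} → G ⟶[ p ] H → Wins p second H → Wins p first G
move⇒wins-first (left-move i)  w = anyF-true⇐ _ i w
move⇒wins-first (right-move j) w = anyF-true⇐ _ j w

wins-second⇒move : ∀ {p G H} → Wins p second G → G ⟶[ opponent p ] H → Wins p first H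
wins-second⇒move {left}  w (right-move j) = allF-true⇒ _ w j
wins-second⇒move {right} w (left-move i)  = allF-true⇒ _ w i

move⇒wins-second : ∀ p {G} → NonAtomic G → (∀ {H} → G ⟶[ opponent p ] H → Wins p first H) →
                   Wins p second G
move⇒wins-second left  {node _ _ _ _} _ w = allF-true⇐ _ (w ∘ right-move)
move⇒wins-second right {node _ _ _ _} _ w = allF-true⇐ _ (w ∘ left-move)

_≺_ : Form → Form → Set
H ≺ G = ∃ λ p → G ⟶[ p ] H

≺-wellFounded : WellFounded _≺_
≺-wellFounded ∞    = acc λ { (_ , ()) }
≺-wellFounded ∞bar = acc λ { (_ , ()) }
≺-wellFounded (node m gL n gR) = acc λ
  { (left  , left-move i)  → ≺-wellFounded (gL i)
  ; (right , right-move j) → ≺-wellFounded (gR j) }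

Atomic : Form → Set
Atomic G = ∃ λ p → G ≡ winner p

nonAtomic? : ∀ G → NonAtomic G ⊎ Atomic G
nonAtomic? ∞                = inj₂ (left , refl)
nonAtomic? ∞bar             = inj₂ (right , refl)
nonAtomic? (node _ _ _ _)   = inj₁ tt

wins-winner : ∀ p t → Wins p t (winner p)
wins-winner left  first  = refl
wins-winner left  second = refl
wins-winner right first  = refl
wins-winner right second = refl

wins-winner⇒≡ : ∀ p q t → Wins p t (winner q) → q ≡ p
wins-winner⇒≡ left  left  t w = refl
wins-winner⇒≡ right right t w = refl
wins-winner⇒≡ left  right first  ()
wins-winner⇒≡ left  right second ()
wins-winner⇒≡ right left  first  ()
wins-winner⇒≡ right left  second ()

winner-⊕ˡ : ∀ p {B} → NonAtomic B → winner p ⊕ B ≡ winner p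
winner-⊕ˡ left  _ = refl
winner-⊕ˡ right {node _ _ _ _} _ = refl

winner-⊕ʳ : ∀ p {A} → NonAtomic A → A ⊕ winner p ≡ winner p
winner-⊕ʳ left  {node _ _ _ _} _ = refl
winner-⊕ʳ right {node _ _ _ _} _ = refl

winner-⊕-winner : ∀ p → winner p ⊕ winner p ≡ winner p
winner-⊕-winner left  = refl
winner-⊕-winner right = refl

⊕-nonAtomic : ∀ {A B} → NonAtomic A → NonAtomic B → NonAtomic (A ⊕ B)
⊕-nonAtomic {node _ _ _ _} {node _ _ _ _} _ _ = tt

⊕-moveˡ : ∀ {p A A′ B} → NonAtomic B → A ⟶[ p ] A′ → (A ⊕ B) ⟶[ p ] (A′ ⊕ B)
⊕-moveˡ {B = node m′ _ _ _} _ (left-move {m} i) =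
  subst (_ ⟶[ left ]_) (cong [ _ , _ ] (splitAt-↑ˡ (suc m) i (suc m′))) (left-move (i ↑ˡ suc m′))
⊕-moveˡ {B = node _ _ n′ _} _ (right-move {n = n} j) =
  subst (_ ⟶[ right ]_) (cong [ _ , _ ] (splitAt-↑ˡ (suc n) j (suc n′))) (right-move (j ↑ˡ suc n′))

⊕-moveʳ : ∀ {p A B B′} → NonAtomic A → B ⟶[ p ] B′ → (A ⊕ B) ⟶[ p ] (A ⊕ B′)
⊕-moveʳ {A = node m _ _ _} _ (left-move {m′} i) =
  subst (_ ⟶[ left ]_) (cong [ _ , _ ] (splitAt-↑ʳ (suc m) (suc m′) i)) (left-move (suc m ↑ʳ i))
⊕-moveʳ {A = node _ _ n _} _ (right-move {n = n′} j) =
  subst (_ ⟶[ right ]_) (cong [ _ , _ ] (splitAt-↑ʳ (suc n) (suc n′) j)) (right-move (suc n ↑ʳ j))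

⊕-move-inv : ∀ {p A B S} → NonAtomic A → NonAtomic B → (A ⊕ B) ⟶[ p ] S →
             (∃ λ A′ → A ⟶[ p ] A′ × S ≡ A′ ⊕ B) ⊎ (∃ λ B′ → B ⟶[ p ] B′ × S ≡ A ⊕ B′)
⊕-move-inv {A = node m _ _ _} {node _ _ _ _} _ _ (left-move i) with splitAt (suc m) i
... | inj₁ j = inj₁ (_ , left-move j , refl)
... | inj₂ j = inj₂ (_ , left-move j , refl)
⊕-move-inv {A = node _ _ n _} {node _ _ _ _} _ _ (right-move i) with splitAt (suc n) i
... | inj₁ j = inj₁ (_ , right-move j , refl)
... | inj₂ j = inj₂ (_ , right-move j , refl)

data Mirror : Form → Set where
  mirror : ∀ {N} → NonAtomic N →
           (∀ {p N′} → N ⟶[ p ] N′ → N′ ≡ winner (opponent p) ⊎ (Mirror N′ × ∀ q → N ⟶[ q ] N′)) →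
           Mirror N

mirror-nonAtomic : ∀ {N} → Mirror N → NonAtomic N
mirror-nonAtomic (mirror nN _) = nN

copycat-atomicˡ : ∀ p {A N X} t₁ t₂ t₃ → NonAtomic N → Atomic A →
                  Wins p t₁ (A ⊕ N) → Wins p t₂ (N ⊕ X) → Wins p t₃ (A ⊕ X)
copycat-atomicˡ p {X = X} t₁ t₂ t₃ nN (q , refl) wAN wNX
  with wins-winner⇒≡ p q t₁ (subst (Wins p t₁) (winner-⊕ˡ q nN) wAN)
... | refl with nonAtomic? X
...   | inj₁ nX = subst (Wins p t₃) (sym (winner-⊕ˡ p nX)) (wins-winner p t₃)
...   | inj₂ (r , refl) with wins-winner⇒≡ p r t₂ (subst (Wins p t₂) (winner-⊕ʳ r nN) wNX)
...     | refl = subst (Wins p t₃) (sym (winner-⊕-winner p)) (wins-winner p t₃)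

copycat-atomicʳ : ∀ p {A N X} t₂ t₃ → NonAtomic A → NonAtomic N → Atomic X →
                  Wins p t₂ (N ⊕ X) → Wins p t₃ (A ⊕ X)
copycat-atomicʳ p t₂ t₃ nA nN (q , refl) wNX
  with wins-winner⇒≡ p q t₂ (subst (Wins p t₂) (winner-⊕ʳ q nN) wNX)
... | refl = subst (Wins p t₃) (sym (winner-⊕ʳ p nA)) (wins-winner p t₃)

loses-suicideˡ : ∀ p t {X} → NonAtomic X → ¬ Wins p t (winner (opponent p) ⊕ X)
loses-suicideˡ p t nX w =
  opponent≢ p (wins-winner⇒≡ p (opponent p) t (subst (Wins p t) (winner-⊕ˡ (opponent p) nX) w))

loses-suicideʳ : ∀ p t {A} → NonAtomic A → ¬ Wins p t (A ⊕ winner (opponent p))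
loses-suicideʳ p t nA w =
  opponent≢ p (wins-winner⇒≡ p (opponent p) t (subst (Wins p t) (winner-⊕ʳ (opponent p) nA) w))

copycat-sf⇒f : ∀ p {A N X} → Mirror N → Acc _≺_ N → Acc _≺_ A → Acc _≺_ X →
               Wins p second (A ⊕ N) → Wins p first (N ⊕ X) → Wins p first (A ⊕ X)
copycat-ss⇒s : ∀ p {A N X} → Mirror N → Acc _≺_ N → Acc _≺_ A → Acc _≺_ X →
               Wins p second (A ⊕ N) → Wins p second (N ⊕ X) → Wins p second (A ⊕ X)
copycat-fs⇒f : ∀ p {A N X} → Mirror N → Acc _≺_ N → Acc _≺_ A → Acc _≺_ X →
               Wins p first (A ⊕ N) → Wins p second (N ⊕ X) → Wins p first (A ⊕ X)

copycat-sf⇒f p {A} {N} {X} mN@(mirror nN options) (acc recN) accA (acc recX) wAN wNX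
  with nonAtomic? A | nonAtomic? X
... | inj₂ aA | _       = copycat-atomicˡ p second first first nN aA wAN wNX
... | inj₁ nA | inj₂ aX = copycat-atomicʳ p first first nA nN aX wNX
... | inj₁ nA | inj₁ nX with wins-first⇒move p (⊕-nonAtomic nN nX) wNX
...   | _ , N⊕X⟶S , wS with ⊕-move-inv nN nX N⊕X⟶S
...     | inj₂ (X′ , X⟶X′ , refl) =
  move⇒wins-first (⊕-moveʳ nA X⟶X′) (copycat-ss⇒s p mN (acc recN) accA (recX (p , X⟶X′)) wAN wS)
...     | inj₁ (N′ , N⟶N′ , refl) with options N⟶N′
...       | inj₁ refl = ⊥-elim (loses-suicideˡ p second nX wS)
...       | inj₂ (mN′ , N⟶ᵩN′) =
  copycat-fs⇒f p mN′ (recN (p , N⟶N′)) accA (acc recX)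
    (wins-second⇒move wAN (⊕-moveʳ nA (N⟶ᵩN′ (opponent p)))) wS

copycat-ss⇒s p {A} {N} {X} mN@(mirror nN _) accN (acc recA) (acc recX) wAN wNX
  with nonAtomic? A | nonAtomic? X
... | inj₂ aA | _       = copycat-atomicˡ p second second second nN aA wAN wNX
... | inj₁ nA | inj₂ aX = copycat-atomicʳ p second second nA nN aX wNX
... | inj₁ nA | inj₁ nX = move⇒wins-second p (⊕-nonAtomic nA nX) reply
  where
  reply : ∀ {S} → (A ⊕ X) ⟶[ opponent p ] S → Wins p first S
  reply A⊕X⟶S with ⊕-move-inv nA nX A⊕X⟶S
  ... | inj₁ (A′ , A⟶A′ , refl) =
    copycat-fs⇒f p mN accN (recA (opponent p , A⟶A′)) (acc recX)
      (wins-second⇒move wAN (⊕-moveˡ nN A⟶A′)) wNX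
  ... | inj₂ (X′ , X⟶X′ , refl) =
    copycat-sf⇒f p mN accN (acc recA) (recX (opponent p , X⟶X′)) wAN
      (wins-second⇒move wNX (⊕-moveʳ nN X⟶X′))

copycat-fs⇒f p {A} {N} {X} mN@(mirror nN options) (acc recN) (acc recA) accX wAN wNX
  with nonAtomic? A | nonAtomic? X
... | inj₂ aA | _       = copycat-atomicˡ p first second first nN aA wAN wNX
... | inj₁ nA | inj₂ aX = copycat-atomicʳ p second first nA nN aX wNX
... | inj₁ nA | inj₁ nX with wins-first⇒move p (⊕-nonAtomic nA nN) wAN
...   | _ , A⊕N⟶S , wS with ⊕-move-inv nA nN A⊕N⟶S
...     | inj₁ (A′ , A⟶A′ , refl) =
  move⇒wins-first (⊕-moveˡ nX A⟶A′) (copycat-ss⇒s p mN (acc recN) (recA (p , A⟶A′)) accX wS wNX)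
...     | inj₂ (N′ , N⟶N′ , refl) with options N⟶N′
...       | inj₁ refl = ⊥-elim (loses-suicideʳ p second nA wS)
...       | inj₂ (mN′ , N⟶ᵩN′) =
  copycat-sf⇒f p mN′ (recN (p , N⟶N′)) (acc recA) accX wS
    (wins-second⇒move wNX (⊕-moveˡ nX (N⟶ᵩN′ (opponent p))))

copycat-first : ∀ p {A N X} → Mirror N →
                Wins p second (A ⊕ N) → Wins p first (N ⊕ X) → Wins p first (A ⊕ X)
copycat-first p {A} {N} {X} mN =
  copycat-sf⇒f p mN (≺-wellFounded N) (≺-wellFounded A) (≺-wellFounded X)

copycat-second : ∀ p {A N X} → Mirror N →
                 Wins p second (A ⊕ N) → Wins p second (N ⊕ X) → Wins p second (A ⊕ X)
copycat-second p {A} {N} {X} mN =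
  copycat-ss⇒s p mN (≺-wellFounded N) (≺-wellFounded A) (≺-wellFounded X)

mirror-⊕-self : ∀ p {N} → Mirror N → Wins p second (N ⊕ N)
mirror-⊕-self p {N} = go (≺-wellFounded N)
  where
  go : ∀ {N} → Acc _≺_ N → Mirror N → Wins p second (N ⊕ N)
  go {N} (acc rec) (mirror nN options) = move⇒wins-second p (⊕-nonAtomic nN nN) reply
    where
    reply : ∀ {S} → (N ⊕ N) ⟶[ opponent p ] S → Wins p first S
    reply N⊕N⟶S with ⊕-move-inv nN nN N⊕N⟶S
    ... | inj₁ (N′ , N⟶N′ , refl) with options N⟶N′
    ...   | inj₁ refl = subst (λ q → Wins p first (winner q ⊕ N)) (sym (opponent-involutive p))
                          (subst (Wins p first) (sym (winner-⊕ˡ p nN)) (wins-winner p first))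
    ...   | inj₂ (mN′ , N⟶ᵩN′) =
      move⇒wins-first (⊕-moveʳ (mirror-nonAtomic mN′) (N⟶ᵩN′ p)) (go (rec (_ , N⟶N′)) mN′)
    reply N⊕N⟶S | inj₂ (N′ , N⟶N′ , refl) with options N⟶N′
    ...   | inj₁ refl = subst (λ q → Wins p first (N ⊕ winner q)) (sym (opponent-involutive p))
                          (subst (Wins p first) (sym (winner-⊕ʳ p nN)) (wins-winner p first))
    ...   | inj₂ (mN′ , N⟶ᵩN′) =
      move⇒wins-first (⊕-moveˡ (mirror-nonAtomic mN′) (N⟶ᵩN′ p)) (go (rec (_ , N⟶N′)) mN′)

outcome≡𝓟⇒ : ∀ S → outcome S ≡ 𝓟 → lf S ≡ false × rf S ≡ false
outcome≡𝓟⇒ S with lf S | rf S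
... | false | false = λ _ → refl , refl
... | false | true  = λ ()
... | true  | false = λ ()
... | true  | true  = λ ()

outcome≡𝓟⇐ : ∀ S → lf S ≡ false → rf S ≡ false → outcome S ≡ 𝓟
outcome≡𝓟⇐ S with lf S | rf S
... | _ | _ = λ { refl refl → refl }

outcome-cong : ∀ S T → lf S ≡ lf T → rf S ≡ rf T → outcome S ≡ outcome T
outcome-cong S T with lf S | rf S | lf T | rf T
... | _ | _ | _ | _ = λ { refl refl → refl }

outcome≡𝓟⇔ : ∀ S → outcome S ≡ 𝓟 ⇔ (∀ p → Wins p second S)
outcome≡𝓟⇔ S = mk⇔ to from
  where
  to : outcome S ≡ 𝓟 → ∀ p → Wins p second S
  to S∈𝓟 left  = not-injective (trans (sym (determinacy left S))  (proj₂ (outcome≡𝓟⇒ S S∈𝓟)))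
  to S∈𝓟 right = not-injective (trans (sym (determinacy right S)) (proj₁ (outcome≡𝓟⇒ S S∈𝓟)))
  from : (∀ p → Wins p second S) → outcome S ≡ 𝓟
  from w = outcome≡𝓟⇐ S (trans (determinacy right S) (cong not (w right)))
                        (trans (determinacy left S)  (cong not (w left)))

wins-second-⊕-mirror : ∀ {A N} → Mirror N → (∀ p → Wins p second (A ⊕ N)) →
                       ∀ q X → wins q second (A ⊕ X) ≡ wins q second (N ⊕ X)
wins-second-⊕-mirror {A} {N} mN A⊕N∈𝓟 q X = ⇔→≡ (mk⇔ to (copycat-second q mN (A⊕N∈𝓟 q)))
  where
  to : Wins q second (A ⊕ X) → Wins q second (N ⊕ X)
  to w with wins q second (N ⊕ X) in e
  ... | true  = refl
  ... | false = subst (λ b → not b ≡ true) w (trans (sym (determinacy q (A ⊕ X))) opponent-wins)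
    where
    opponent-wins : Wins (opponent q) first (A ⊕ X)
    opponent-wins = copycat-first (opponent q) mN (A⊕N∈𝓟 (opponent q))
                      (trans (determinacy q (N ⊕ X)) (cong not e))

outcome-⊕-mirror : ∀ {N} → Mirror N → ∀ A → outcome (A ⊕ N) ≡ 𝓟 →
                   ∀ X → outcome (A ⊕ X) ≡ outcome (N ⊕ X)
outcome-⊕-mirror {N} mN A A⊕N∈𝓟 X =
  outcome-cong (A ⊕ X) (N ⊕ X) (first-equal right) (first-equal left)
  where
  first-equal : ∀ q → wins (opponent q) first (A ⊕ X) ≡ wins (opponent q) first (N ⊕ X)
  first-equal q = begin
    wins (opponent q) first (A ⊕ X) ≡⟨ determinacy q (A ⊕ X) ⟩
    not (wins q second (A ⊕ X))     ≡⟨ cong not (wins-second-⊕-mirror mN A⊕N∈𝓟′ q X) ⟩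
    not (wins q second (N ⊕ X))     ≡⟨ sym (determinacy q (N ⊕ X)) ⟩
    wins (opponent q) first (N ⊕ X) ∎
    where
    open ≡-Reasoning
    A⊕N∈𝓟′ = Equivalence.to (outcome≡𝓟⇔ (A ⊕ N)) A⊕N∈𝓟

nim-nonAtomic : ∀ n → NonAtomic (nim n)
nim-nonAtomic zero    = tt
nim-nonAtomic (suc k) = tt

below-option : ∀ k i q → nim (suc k) ⟶[ q ] below (suc k) i
below-option k i left  = left-move i
below-option k i right = right-move i

mirror-nim : ∀ n → Mirror (nim n)
mirror-below : ∀ k i → Mirror (below k i)
nim-option-mirror : ∀ n {p N′} → nim n ⟶[ p ] N′ →
                    N′ ≡ winner (opponent p) ⊎ (Mirror N′ × ∀ q → nim n ⟶[ q ] N′)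

mirror-nim n = mirror (nim-nonAtomic n) (nim-option-mirror n)

mirror-below (suc k) zero    = mirror-nim k
mirror-below (suc k) (suc i) = mirror-below k i

nim-option-mirror zero    (left-move zero)  = inj₁ refl
nim-option-mirror zero    (right-move zero) = inj₁ refl
nim-option-mirror (suc k) (left-move i)     = inj₂ (mirror-below (suc k) i , below-option k i)
nim-option-mirror (suc k) (right-move i)    = inj₂ (mirror-below (suc k) i , below-option k i)

below-nim : ∀ k i → ∃ λ j → below k i ≡ nim j
below-nim (suc k) zero    = k , refl
below-nim (suc k) (suc i) = below-nim k i

AtomOrNimber : Form → Set
AtomOrNimber G = Atomic G ⊎ ∃ λ k → G ≡ nim k

nim-option : ∀ {k p H} → nim k ⟶[ p ] H → AtomOrNimber H
nim-option {zero}  (left-move zero)  = inj₁ (right , refl)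
nim-option {zero}  (right-move zero) = inj₁ (left , refl)
nim-option {suc k} (left-move i)     = inj₂ (below-nim (suc k) i)
nim-option {suc k} (right-move i)    = inj₂ (below-nim (suc k) i)

winner-has-no-moves : ∀ {p q H} → ¬ (winner q ⟶[ p ] H)
winner-has-no-moves {q = left}  ()
winner-has-no-moves {q = right} ()

atomOrNimber-option : ∀ {p G H} → G ⟶[ p ] H → AtomOrNimber G → AtomOrNimber H
atomOrNimber-option G⟶H (inj₁ (_ , refl)) = ⊥-elim (winner-has-no-moves G⟶H)
atomOrNimber-option G⟶H (inj₂ (_ , refl)) = nim-option G⟶H

follower-closed : ∀ (P : Form → Set) → (∀ {p G H} → G ⟶[ p ] H → P G → P H) →
                  ∀ {F G} → Follower F G → P G → P F
follower-closed P step self       = λ pG → pG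
follower-closed P step (viaL i f) = follower-closed P step f ∘ step (left-move i)
follower-closed P step (viaR j f) = follower-closed P step f ∘ step (right-move j)

nim≅conj : ∀ n → nim n ≅ conj (nim n)
below≅conj : ∀ k i → below k i ≅ conj (below k i)
nim≅conj zero = ((λ _ → zero , tt) , (λ _ → zero , tt)) , ((λ _ → zero , tt) , (λ _ → zero , tt))
nim≅conj (suc k) = ((λ i → i , below≅conj (suc k) i) , (λ j → j , below≅conj (suc k) j)) ,
                   ((λ i → i , below≅conj (suc k) i) , (λ j → j , below≅conj (suc k) j))
below≅conj (suc k) zero    = nim≅conj k
below≅conj (suc k) (suc i) = below≅conj k i

nim-symmetric : ∀ n → Symmetric (nim n)
nim-symmetric zero    = (λ _ → zero , tt) , (λ _ → zero , tt)
nim-symmetric (suc k) = (λ j → j , below≅conj (suc k) j) , (λ i → i , below≅conj (suc k) i)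

nim-impartial : ∀ n → Impartial (nim n)
nim-impartial n = nim-symmetric n , λ F F≼nim →
  quiet-symmetric (follower-closed AtomOrNimber atomOrNimber-option F≼nim (inj₂ (n , refl)))
  where
  quiet-symmetric : ∀ {F} → AtomOrNimber F → Quiet F → Symmetric F
  quiet-symmetric (inj₁ (left  , refl)) (() , _)
  quiet-symmetric (inj₁ (right , refl)) (() , _)
  quiet-symmetric (inj₂ (k , refl)) _ = nim-symmetric k

theorem3p6 : (G : Form) → Impartial G → (n : ℕ) →
    (G =Im nim n) ⇔ (outcome (G ⊕ nim n) ≡ 𝓟)
theorem3p6 G _ n = mk⇔ to from
  where
  nim⊕nim∈𝓟 : outcome (nim n ⊕ nim n) ≡ 𝓟
  nim⊕nim∈𝓟 = Equivalence.from (outcome≡𝓟⇔ _) (λ p → mirror-⊕-self p (mirror-nim n))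
  to : G =Im nim n → outcome (G ⊕ nim n) ≡ 𝓟
  to G=n = trans (G=n (nim n) (nim-impartial n)) nim⊕nim∈𝓟
  from : outcome (G ⊕ nim n) ≡ 𝓟 → G =Im nim n
  from G⊕n∈𝓟 X _ = outcome-⊕-mirror (mirror-nim n) G G⊕n∈𝓟 X
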